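{- Let $r$ and $k_A$ be positive integers and $a_1,\ldots,a_r$ positive integers. If $\Delta_A = k_A^r$ and $\Delta_B = \sum_{i=1}^r a_i^{k_A}$, then $K_{\Delta_B,\Delta_A}$ is not $(k_A, \sum_{i=1}^r a_i)$-choosable.
   Context: All graphs are finite and simple. For a bipartite graph $G$ with bipartition $V = A \sqcup B$ and positive integers $k_A, k_B$, $G$ is $(k_A,k_B)$-choosable if for every set of colors $C$ and every list assignment $L$ assigning to each vertex of $A$ a $k_A$-element subset of $C$ and to each vertex of $B$ a $k_B$-element subset of $C$, there is a map $c\colon V\to C$ with $c(v)\in L(v)$ for all $v$ and $c(v)\neq c(v')$ for every edge $vv'$. For the complete bipartite graph $K_{\Delta_B,\Delta_A}$ the part $A$ has $\Delta_B$ vertices and the part $B$ has $\Delta_A$ vertices. -}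

module Defs where

open import Data.Nat using (ℕ; _+_; _^_)
open import Data.Fin using (Fin)
open import Data.Product using (Σ; ∃; _×_)
open import Data.Unit using (⊤)
open import Relation.Binary.PropositionalEquality using (_≡_)
open import Relation.Nullary using (¬_)
open import Function.Definitions using (Injective)
open import Level using (0ℓ)

-- A bipartite graph with parts A = Fin m and B = Fin n, given by its
-- edge relation between A and B (all edges go between the parts, so the
-- graph is automatically simple and loopless).
record BipartiteGraph (m n : ℕ) : Set₁ where
  field
    edge : Fin m → Fin n → Set

record Subset (k : ℕ) (C : Set) : Set where
  field
    elem : Fin k → C
    elem-inj : Injective _≡_ _≡_ elem
open Subset public

_∈ₛ_ : {k : ℕ} {C : Set} → C → Subset k C → Set
x ∈ₛ S = Σ (Fin _) (λ i → elem S i ≡ x)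

Choosable : {m n : ℕ} → BipartiteGraph m n → ℕ → ℕ → Set₁
Choosable {m} {n} G kA kB =
  (C : Set) (LA : Fin m → Subset kA C) (LB : Fin n → Subset kB C) →
  Σ (Fin m → C) λ cA → Σ (Fin n → C) λ cB →
    ((a : Fin m) → cA a ∈ₛ LA a) ×
    ((b : Fin n) → cB b ∈ₛ LB b) ×
    ((a : Fin m) (b : Fin n) → BipartiteGraph.edge G a b → ¬ (cA a ≡ cB b))

K : (m n : ℕ) → BipartiteGraph m n
K m n = record { edge = λ _ _ → ⊤ }

sumFin : (r : ℕ) → (Fin r → ℕ) → ℕ
sumFin ℕ.zero f = 0
sumFin (ℕ.suc r) f = f Fin.zero + sumFin r (λ i → f (Fin.suc i))

-- Colours are triples (i , j , x) with i < r, j < kA and x < aᵢ. The A-vertex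
-- (i , g), for g : Fin kA → Fin aᵢ, gets the list {(i , j , g j) | j < kA}; the
-- B-vertex f : Fin r → Fin kA gets {(i , f i , x) | i < r, x < aᵢ}. A colouring
-- of the A-vertices of row i selects a coordinate h g for every g, and some
-- coordinate jᵢ is then full: every colour (i , jᵢ , x) is used in row i. The
-- B-vertex i ↦ jᵢ therefore sees all of its colours on its neighbours.
module Submission where

open import Defs
open import Data.Nat using (ℕ; _^_; NonZero; suc)
open import Data.Fin using (Fin; zero; suc; splitAt; join; finToFun; funToFin; _≟_)
open import Data.Fin.Properties using (splitAt-join; join-splitAt; finToFun-funToFin; any?; all?; ¬∀⟶∃¬)
open import Data.Product using (Σ; ∃; ∃₂; _×_; _,_; proj₁; proj₂)
import Data.Product as Product
open import Data.Sum using (_⊎_; inj₁; inj₂; [_,_]′)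
open import Data.Unit using (tt)
open import Data.Empty using (⊥-elim)
open import Function using (_∘_; id)
open import Function.Definitions using (Injective)
open import Relation.Nullary using (¬_; Dec; yes; no; _×-dec_)
open import Relation.Binary.PropositionalEquality using (_≡_; _≗_; refl; sym; trans; cong; subst; module ≡-Reasoning)

splitSum : (r : ℕ) (b : Fin r → ℕ) → Fin (sumFin r b) → Σ (Fin r) (Fin ∘ b)
splitSum (suc r) b = [ (zero ,_) , Product.map suc id ∘ splitSum r (b ∘ suc) ]′ ∘ splitAt (b zero)

joinSum : (r : ℕ) (b : Fin r → ℕ) → Σ (Fin r) (Fin ∘ b) → Fin (sumFin r b)
joinSum (suc r) b (zero  , x) = join (b zero) _ (inj₁ x)
joinSum (suc r) b (suc i , x) = join (b zero) _ (inj₂ (joinSum r (b ∘ suc) (i , x)))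

splitSum-joinSum : (r : ℕ) (b : Fin r → ℕ) (p : Σ (Fin r) (Fin ∘ b)) → splitSum r b (joinSum r b p) ≡ p
splitSum-joinSum (suc r) b (zero , x) =
  cong [ (zero ,_) , Product.map suc id ∘ splitSum r (b ∘ suc) ]′ (splitAt-join (b zero) _ (inj₁ x))
splitSum-joinSum (suc r) b (suc i , x) =
  trans (cong [ (zero ,_) , Product.map suc id ∘ splitSum r (b ∘ suc) ]′ (splitAt-join (b zero) _ (inj₂ _)))
        (cong (Product.map suc id) (splitSum-joinSum r (b ∘ suc) (i , x)))

joinSum-splitSum : (r : ℕ) (b : Fin r → ℕ) (t : Fin (sumFin r b)) → joinSum r b (splitSum r b t) ≡ t
joinSum-splitSum (suc r) b t = trans (joinSum-split (splitAt (b zero) t)) (join-splitAt (b zero) _ t)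
  where
  joinSum-split : (s : Fin (b zero) ⊎ Fin (sumFin r (b ∘ suc))) →
    joinSum (suc r) b ([ (zero ,_) , Product.map suc id ∘ splitSum r (b ∘ suc) ]′ s) ≡ join (b zero) _ s
  joinSum-split (inj₁ x) = refl
  joinSum-split (inj₂ t) = cong (join (b zero) _ ∘ inj₂) (joinSum-splitSum r (b ∘ suc) t)

splitSum-injective : (r : ℕ) (b : Fin r → ℕ) → Injective _≡_ _≡_ (splitSum r b)
splitSum-injective r b {t} {t′} e =
  trans (sym (joinSum-splitSum r b t)) (trans (cong (joinSum r b) e) (joinSum-splitSum r b t′))

∃-full-coordinate : {m k n : ℕ} (dec : Fin m → Fin k → Fin n) → (∀ g → ∃ λ v → dec v ≗ g) →
  (h : Fin m → Fin k) → ∃ λ j → ∀ x → ∃ λ v → h v ≡ j × dec v j ≡ x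
∃-full-coordinate {k = k} {n} dec dec-surjective h = from-dec (any? λ j → all? λ x → hit? j x)
  where
  Hit : Fin k → Fin n → Set
  Hit j x = ∃ λ v → h v ≡ j × dec v j ≡ x
  hit? : ∀ j x → Dec (Hit j x)
  hit? j x = any? λ v → (h v ≟ j) ×-dec (dec v j ≟ x)
  from-dec : Dec (∃ λ j → ∀ x → Hit j x) → ∃ λ j → ∀ x → Hit j x
  from-dec (yes full) = full
  -- Otherwise choose, for every j, a value missed at j; the vertex realising
  -- this choice is hit at its own coordinate.
  from-dec (no ¬full) = ⊥-elim (chosen-is-hit (dec-surjective (proj₁ ∘ missed)))
    where
    missed : (j : Fin k) → ∃ λ x → ¬ Hit j x
    missed j = ¬∀⟶∃¬ n (Hit j) (hit? j) (λ all → ¬full (j , all))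
    chosen-is-hit : ¬ ∃ λ v → dec v ≗ proj₁ ∘ missed
    chosen-is-hit (v , dec-v) = proj₂ (missed (h v)) (v , refl , dec-v (h v))

module _ (r kA : ℕ) (a : Fin r → ℕ) where

  Colour : Set
  Colour = Σ (Fin r) λ i → Fin kA × Fin (a i)

  RowVertex : Set
  RowVertex = Σ (Fin r) λ i → Fin (a i ^ kA)

  rowList : RowVertex → Subset kA Colour
  rowList (i , c) = record
    { elem     = λ j → i , j , finToFun c j
    ; elem-inj = cong (proj₁ ∘ proj₂)
    }

  transversalList : Fin (kA ^ r) → Subset (sumFin r a) Colour
  transversalList w = record
    { elem     = λ t → let (i , x) = splitSum r a t in i , finToFun w i , x
    ; elem-inj = λ e → splitSum-injective r a (cong (λ { (i , _ , x) → i , x }) e)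
    }

  module _ (cA : Fin (sumFin r (λ i → a i ^ kA)) → Colour)
           (cA∈ : ∀ v → cA v ∈ₛ rowList (splitSum r (λ i → a i ^ kA) v)) where

    private
      cA∈rowList : (p : RowVertex) → cA (joinSum r _ p) ∈ₛ rowList p
      cA∈rowList p = subst (λ q → cA (joinSum r _ p) ∈ₛ rowList q) (splitSum-joinSum r _ p) (cA∈ (joinSum r _ p))

    full-coordinate : (i : Fin r) → ∃ λ j → ∀ x → ∃ λ c → cA (joinSum r _ (i , c)) ≡ (i , j , x)
    full-coordinate i =
      Product.map₂ (used ∘_)
        (∃-full-coordinate finToFun (λ g → funToFin g , finToFun-funToFin g) chosen)
      where
      chosen : Fin (a i ^ kA) → Fin kA
      chosen c = proj₁ (cA∈rowList (i , c))
      used : ∀ {j x} → (∃ λ c → chosen c ≡ j × finToFun c j ≡ x) → ∃ λ c → cA (joinSum r _ (i , c)) ≡ (i , j , x)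
      used {j} {x} (c , chosen≡j , c≡x) = c , (begin
        cA (joinSum r _ (i , c))              ≡⟨ sym (proj₂ (cA∈rowList (i , c))) ⟩
        (i , chosen c , finToFun c (chosen c)) ≡⟨ cong (λ j′ → i , j′ , finToFun c j′) chosen≡j ⟩
        (i , j , finToFun c j)                ≡⟨ cong (λ y → i , j , y) c≡x ⟩
        (i , j , x)                           ∎)
        where open ≡-Reasoning

    colour-clash : (cB : Fin (kA ^ r) → Colour) → (∀ w → cB w ∈ₛ transversalList w) →
      ∃₂ λ v w → cA v ≡ cB w
    colour-clash cB cB∈ = joinSum r _ (i , c) , w , (begin
      cA (joinSum r _ (i , c)) ≡⟨ c-colour ⟩
      (i , f i , x)            ≡⟨ cong (λ j → i , j , x) (sym (finToFun-funToFin f i)) ⟩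
      (i , finToFun w i , x)   ≡⟨ proj₂ (cB∈ w) ⟩
      cB w                     ∎)
      where
      open ≡-Reasoning
      f : Fin r → Fin kA
      f = proj₁ ∘ full-coordinate
      w : Fin (kA ^ r)
      w = funToFin f
      i : Fin r
      i = proj₁ (splitSum r a (proj₁ (cB∈ w)))
      x : Fin (a i)
      x = proj₂ (splitSum r a (proj₁ (cB∈ w)))
      c : Fin (a i ^ kA)
      c = proj₁ (proj₂ (full-coordinate i) x)
      c-colour : cA (joinSum r _ (i , c)) ≡ (i , f i , x)
      c-colour = proj₂ (proj₂ (full-coordinate i) x)

  K-not-choosable : ¬ Choosable (K (sumFin r (λ i → a i ^ kA)) (kA ^ r)) kA (sumFin r a)
  K-not-choosable choosable =
    let (cA , cB , cA∈ , cB∈ , proper) = choosable Colour (rowList ∘ splitSum r _) transversalList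
        (v , w , clash) = colour-clash cA cA∈ cB cB∈
    in proper v w tt clash

proposition2p2 : (r kA : ℕ) → NonZero r → NonZero kA →
    (a : Fin r → ℕ) → ((i : Fin r) → NonZero (a i)) →
    (ΔA ΔB : ℕ) → ΔA ≡ kA ^ r → ΔB ≡ sumFin r (λ i → a i ^ kA) →
    ¬ Choosable (K ΔB ΔA) kA (sumFin r a)
proposition2p2 r kA _ _ a _ _ _ refl refl = K-not-choosable r kA a
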